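{- For every integer $n\ge 2$, ${\rm tree}\text{ - }\alpha(C(\overline{K_n}))=n-1$.
   Context: $\overline{K_n}$ denotes the edgeless graph on $n$ vertices. For a graph $H$, the 1-completion $C(H)$ is the graph obtained from $H$ by, for each pair of non-adjacent vertices $u,v$ of $H$, adding a new vertex of degree $2$ adjacent to exactly $u$ and $v$. A tree-decomposition of a graph $G$ is a pair $(T,\{X_t\}_{t\in V(T)})$ where $T$ is a tree and $X_t\subseteq V(G)$, such that every edge of $G$ has both ends in some $X_t$ and for every vertex $v$ the nodes $t$ with $v\in X_t$ induce a non-empty connected subtree of $T$. ${\rm tree}\text{ - }\alpha(G)$ is the minimum over tree-decompositions of $G$ of $\max_t\alpha(G[X_t])$, $\alpha$ denoting the independence number. -}

module Defs where

open import Data.Nat using (ℕ; zero; suc; _≤_; _<_)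
open import Data.Fin using (Fin; toℕ; inject₁) renaming (suc to fsuc)
open import Data.Fin as F using ()
open import Data.Product using (Σ; _×_; _,_; ∃; ∃-syntax)
open import Data.Sum using (_⊎_; inj₁; inj₂)
open import Data.Empty using (⊥)
open import Data.List using (List; length)
open import Data.List.Membership.Propositional using (_∈_)
open import Data.List.Relation.Unary.All using (All)
open import Data.List.Relation.Unary.Unique.Propositional using (Unique)
open import Relation.Nullary using (¬_)
open import Relation.Binary.PropositionalEquality using (_≡_)

record Graph : Set₁ where
  field
    V : Set
    E : V → V → Set
open Graph public

IndepIn : (G : Graph) → (V G → Set) → List (V G) → Set
IndepIn G X xs =
  Unique xs × All X xs × (∀ {u v} → u ∈ xs → v ∈ xs → ¬ E G u v)

αInduced≤ : (G : Graph) → (V G → Set) → ℕ → Set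
αInduced≤ G X k = ∀ xs → IndepIn G X xs → length xs ≤ k

-- Trees.  A finite tree with node set Fin (suc k); node (suc i) is joined
-- to its parent, which has a smaller index (every finite tree admits
-- such a labelling, e.g. by BFS order).

record Tree : Set where
  field
    size   : ℕ                        -- tree has (suc size) nodes
    parent : (i : Fin size) → Fin (suc size)
    parent< : (i : Fin size) → toℕ (parent i) ≤ toℕ i
open Tree public

Node : Tree → Set
Node T = Fin (suc (size T))

TEdge : (T : Tree) → Node T → Node T → Set
TEdge T s t = (Σ (Fin (size T)) λ i → (s ≡ fsuc i) × (t ≡ parent T i))
            ⊎ (Σ (Fin (size T)) λ i → (t ≡ fsuc i) × (s ≡ parent T i))

data WalkIn (T : Tree) (S : Node T → Set) : Node T → Node T → Set where
  here : ∀ {s} → S s → WalkIn T S s s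
  step : ∀ {s t u} → S s → TEdge T s t → WalkIn T S t u → WalkIn T S s u

ConnectedNonempty : (T : Tree) → (Node T → Set) → Set
ConnectedNonempty T S = (∃ λ t → S t) × (∀ s t → S s → S t → WalkIn T S s t)

record TreeDecomposition (G : Graph) : Set₁ where
  field
    tree : Tree
    bag  : Node tree → V G → Set
    edgeCovered : ∀ u v → E G u v → ∃ λ t → bag t u × bag t v
    vertexConnected : ∀ v → ConnectedNonempty tree (λ t → bag t v)
open TreeDecomposition public

TDαWidth≤ : (G : Graph) → TreeDecomposition G → ℕ → Set
TDαWidth≤ G D k = ∀ t → αInduced≤ G (bag D t) k

TreeαAtMost : Graph → ℕ → Set₁
TreeαAtMost G k = Σ (TreeDecomposition G) λ D → TDαWidth≤ G D k

TreeαIs : Graph → ℕ → Set₁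
TreeαIs G k = TreeαAtMost G k × (∀ m → TreeαAtMost G m → k ≤ m)

-- 1-completion of the graph on Fin m with adjacency relation A:
-- vertices are the old vertices plus one new vertex for each pair
-- i < j of non-adjacent vertices, adjacent exactly to i and j.
CompVertex : (m : ℕ) → (Fin m → Fin m → Set) → Set
CompVertex m A = Fin m ⊎ (Σ (Fin m) λ i → Σ (Fin m) λ j → (toℕ i < toℕ j) × ¬ A i j)

data CompEdge (m : ℕ) (A : Fin m → Fin m → Set) : CompVertex m A → CompVertex m A → Set where
  old   : ∀ {i j} → A i j → CompEdge m A (inj₁ i) (inj₁ j)
  newL  : ∀ {i j} (p : toℕ i < toℕ j) (q : ¬ A i j) → CompEdge m A (inj₂ (i , j , p , q)) (inj₁ i)
  newR  : ∀ {i j} (p : toℕ i < toℕ j) (q : ¬ A i j) → CompEdge m A (inj₂ (i , j , p , q)) (inj₁ j)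
  newL' : ∀ {i j} (p : toℕ i < toℕ j) (q : ¬ A i j) → CompEdge m A (inj₁ i) (inj₂ (i , j , p , q))
  newR' : ∀ {i j} (p : toℕ i < toℕ j) (q : ¬ A i j) → CompEdge m A (inj₁ j) (inj₂ (i , j , p , q))

completion : (m : ℕ) → (Fin m → Fin m → Set) → Graph
completion m A = record { V = CompVertex m A ; E = CompEdge m A }

edgeless : (n : ℕ) → Fin n → Fin n → Set
edgeless n _ _ = ⊥

CKbar : ℕ → Graph
CKbar n = completion n (edgeless n)

{-# OPTIONS --safe #-}
module Submission where

-- Write m_xy for the midpoint of x and y, the new vertex of C(K̄ₙ) adjacent to exactly x and y.
--
-- Upper bound: a star decomposition around the original vertex 0 in which every bag is covered
-- by n − 1 cliques.
--
-- Lower bound: root a tree-decomposition and walk down from the root as long as every original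
-- vertex occurs in the current subtree.  If the current bag contains all originals, these are n
-- independent vertices.  Otherwise the walk stops at an edge from a node p to a child c such that
-- some original a occurs below c but not in X_p, while some original b does not occur below c.
-- For every j ≠ a, X_p then contains j itself, m_aj or m_jb, because the subtree of that vertex
-- must cross the edge c p; these n − 1 vertices are independent.

open import Defs
open import Data.Nat using (ℕ; _≤_; _<_; _∸_; _*_; zero; suc; z≤n; s≤s)
open import Data.Nat.Properties using (<⇒≱; ≮⇒≥; ≰⇒>; _≤?_)
open import Data.Fin as F using (Fin; toℕ; combine; punchIn) renaming (zero to fz; suc to fsuc)
open import Data.Fin.Properties
  using (<-cmp; <-irrelevant; <⇒≢; combine-injective; punchIn-injective; punchInᵢ≢i; pigeonhole)
open import Data.Fin.Induction using (<-wellFounded; >-wellFounded)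
open import Data.Product using (Σ; _×_; _,_; ∃; proj₁; proj₂)
import Data.Product as Product
open import Data.Sum using (_⊎_; inj₁; inj₂; [_,_]; swap)
open import Data.Empty using (⊥; ⊥-elim)
open import Data.List using (List; _∷_; length; tabulate; lookup)
open import Data.List.Membership.Propositional using (_∈_)
open import Data.List.Membership.Propositional.Properties using (∈-tabulate⁻; ∈-lookup)
open import Data.List.Properties using (length-tabulate)
import Data.List.Relation.Unary.All as All
open import Data.List.Relation.Unary.All.Properties using (tabulate⁺)
open import Data.List.Relation.Unary.AllPairs using (_∷_)
open import Data.List.Relation.Unary.Unique.Propositional using (Unique)
import Data.List.Relation.Unary.Unique.Propositional.Properties as Unique
open import Function using (_∘_; id)
open import Function.Definitions using (Injective)
open import Induction.WellFounded using (Acc; acc)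
open import Relation.Nullary using (¬_; Dec; yes; no; contradiction)
open import Relation.Nullary.Decidable using (¬¬-excluded-middle; map′)
open import Relation.Binary.PropositionalEquality using (_≡_; _≢_; refl; sym; trans; cong; subst)
open import Relation.Binary.Definitions using (tri<; tri≈; tri>)

¬¬-Π-Fin : ∀ {n} {P : Fin n → Set} → (∀ j → ¬ ¬ P j) → ¬ ¬ (∀ j → P j)
¬¬-Π-Fin {zero} _ k = k λ ()
¬¬-Π-Fin {suc n} h k = h fz λ p₀ → ¬¬-Π-Fin (h ∘ fsuc) λ ps → k λ { fz → p₀ ; (fsuc j) → ps j }

Unique⇒lookup-injective : ∀ {A : Set} {xs : List A} → Unique xs →
  ∀ i j → i ≢ j → lookup xs i ≢ lookup xs j
Unique⇒lookup-injective {xs = _ ∷ _}  (_ ∷ _)  fz       fz       i≢j _  = i≢j refl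
Unique⇒lookup-injective {xs = _ ∷ xs} (x∉ ∷ _) fz       (fsuc j) _   eq =
  All.lookup x∉ (∈-lookup {xs = xs} j) eq
Unique⇒lookup-injective {xs = _ ∷ xs} (x∉ ∷ _) (fsuc i) fz       _   eq =
  All.lookup x∉ (∈-lookup {xs = xs} i) (sym eq)
Unique⇒lookup-injective {xs = _ ∷ _}  (_ ∷ u)  (fsuc i) (fsuc j) i≢j =
  Unique⇒lookup-injective u i j (i≢j ∘ cong fsuc)

module _ (G : Graph) where

  record IndependentFamily (X : V G → Set) (k : ℕ) : Set where
    field
      member      : Fin k → V G
      injective   : Injective _≡_ _≡_ member
      inside      : ∀ r → X (member r)
      nonadjacent : ∀ r r′ → ¬ E G (member r) (member r′)

  independentFamily-size≤ : ∀ {X k m} → αInduced≤ G X m → IndependentFamily X k → k ≤ m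
  independentFamily-size≤ α≤m F =
    subst (_≤ _) (length-tabulate member)
      (α≤m (tabulate member) (Unique.tabulate⁺ injective , tabulate⁺ inside , nonadjacent′))
    where
    open IndependentFamily F
    nonadjacent′ : ∀ {u w} → u ∈ tabulate member → w ∈ tabulate member → ¬ E G u w
    nonadjacent′ u∈ w∈ with ∈-tabulate⁻ u∈ | ∈-tabulate⁻ w∈
    ... | r , refl | r′ , refl = nonadjacent r r′

  cliqueCover⇒αInduced≤ : ∀ {X k} (colour : ∀ {u} → X u → Fin k) →
    (∀ {u w} (xu : X u) (xw : X w) → colour xu ≡ colour xw → u ≡ w ⊎ E G u w) →
    αInduced≤ G X k
  cliqueCover⇒αInduced≤ {k = k} colour clique xs (unique , inX , independent) with length xs ≤? k
  ... | yes ≤k = ≤k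
  ... | no ≰k with pigeonhole (≰⇒> ≰k) (λ r → colour (All.lookup inX (∈-lookup {xs = xs} r)))
  ...   | r , r′ , r<r′ , same with clique _ _ same
  ...     | inj₁ eq   = ⊥-elim (Unique⇒lookup-injective unique r r′ (<⇒≢ r<r′) eq)
  ...     | inj₂ edge = ⊥-elim (independent (∈-lookup {xs = xs} r) (∈-lookup {xs = xs} r′) edge)

module RootedTree (T : Tree) where

  infix 4 _≼_

  data _≼_ : Node T → Node T → Set where
    ≼-refl : ∀ {c} → c ≼ c
    ≼-step : ∀ {c} i → parent T i ≼ c → fsuc i ≼ c

  parent<child : ∀ i → parent T i F.< fsuc i
  parent<child i = s≤s (parent< T i)

  ancestor-induction : (P : Node T → Set) → P fz → (∀ i → P (parent T i) → P (fsuc i)) → ∀ x → P x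
  ancestor-induction P P-root P-child x = go x (<-wellFounded x)
    where
    go : ∀ x → Acc F._<_ x → P x
    go fz       _        = P-root
    go (fsuc i) (acc rs) = P-child i (go (parent T i) (rs (parent<child i)))

  ≼-root : ∀ x → x ≼ fz
  ≼-root = ancestor-induction (_≼ fz) ≼-refl ≼-step

  _≼?_ : ∀ x c → Dec (x ≼ c)
  x ≼? c = ancestor-induction (λ x → Dec (x ≼ c)) root? step? x
    where
    root? : Dec (fz ≼ c)
    root? with c F.≟ fz
    ... | yes refl = yes ≼-refl
    ... | no c≢fz  = no λ { ≼-refl → c≢fz refl }
    step? : ∀ i → Dec (parent T i ≼ c) → Dec (fsuc i ≼ c)
    step? i parent≼? with fsuc i F.≟ c
    ... | yes refl = yes ≼-refl
    ... | no i≢c   =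
      map′ (≼-step i) (λ { ≼-refl → contradiction refl i≢c ; (≼-step _ p≼c) → p≼c }) parent≼?

  ≼-child : ∀ {x t} → x ≼ t → x ≢ t → ∃ λ i → parent T i ≡ t × x ≼ fsuc i
  ≼-child ≼-refl x≢t = contradiction refl x≢t
  ≼-child {t = t} (≼-step j p≼t) _ with parent T j F.≟ t
  ... | yes p≡t = j , p≡t , ≼-refl
  ... | no p≢t with ≼-child p≼t p≢t
  ...   | i , eq , p≼c = i , eq , ≼-step j p≼c

  walk-start : ∀ {S x y} → WalkIn T S x y → S x
  walk-start (here Sx)     = Sx
  walk-start (step Sx _ _) = Sx

  walk-leaving-subtree : ∀ {S x y} i → WalkIn T S x y → x ≼ fsuc i → ¬ y ≼ fsuc i → S (parent T i)
  walk-leaving-subtree i (here _) x≼c y⋠c = contradiction x≼c y⋠c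
  walk-leaving-subtree i (step _ (inj₁ (_ , refl , refl)) w) ≼-refl y⋠c = walk-start w
  walk-leaving-subtree i (step _ (inj₁ (_ , refl , refl)) w) (≼-step _ p≼c) y⋠c =
    walk-leaving-subtree i w p≼c y⋠c
  walk-leaving-subtree i (step _ (inj₂ (j , refl , refl)) w) x≼c y⋠c =
    walk-leaving-subtree i w (≼-step j x≼c) y⋠c

  walk-confined : ∀ {S x y} i → ¬ S (parent T i) → WalkIn T S x y → x ≼ fsuc i → y ≼ fsuc i
  walk-confined {y = y} i ¬Sp w x≼c with y ≼? fsuc i
  ... | yes y≼c = y≼c
  ... | no y⋠c  = contradiction (walk-leaving-subtree i w x≼c y⋠c) ¬Sp

  singleton-connected : ∀ {S : Node T → Set} {u} → S u → (∀ s → S s → s ≡ u) → ConnectedNonempty T S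
  singleton-connected {S} {u} Su only-u = (u , Su) , λ s t Ss St →
    subst (λ s → WalkIn T S s t) (sym (only-u s Ss)) (subst (WalkIn T S u) (sym (only-u t St)) (here Su))

module _ {G : Graph} (D : TreeDecomposition G) where
  open RootedTree (tree D)

  OccursBelow : Node (tree D) → V G → Set
  OccursBelow c u = ∃ λ x → x ≼ c × bag D x u

  occurs-below-root : ∀ u → OccursBelow fz u
  occurs-below-root u with proj₁ (vertexConnected D u)
  ... | x , u∈x = x , ≼-root x , u∈x

  escape-to-child : ∀ {t u} → OccursBelow t u → ¬ bag D t u →
    ∃ λ i → parent (tree D) i ≡ t × OccursBelow (fsuc i) u
  escape-to-child (x , x≼t , u∈x) u∉t with ≼-child x≼t (λ { refl → u∉t u∈x })
  ... | i , eq , x≼c = i , eq , x , x≼c , u∈x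

  -- The subtree of s meets both sides of the edge between fsuc i and its parent.
  common-neighbour-in-parent-bag : ∀ {s a b} i → E G s a → E G s b →
    OccursBelow (fsuc i) a → ¬ bag D (parent (tree D) i) a → ¬ OccursBelow (fsuc i) b →
    bag D (parent (tree D) i) s
  common-neighbour-in-parent-bag {s} {a} {b} i sa sb (x , x≼c , a∈x) a∉p b-absent
    with edgeCovered D s a sa | edgeCovered D s b sb
  ... | y , s∈y , a∈y | z , s∈z , b∈z =
    walk-leaving-subtree i (walk s s∈y s∈z) y≼c (λ z≼c → b-absent (z , z≼c , b∈z))
    where
    walk : ∀ u {x y} → bag D x u → bag D y u → WalkIn (tree D) (λ t → bag D t u) x y
    walk u = proj₂ (vertexConnected D u) _ _
    y≼c : y ≼ fsuc i
    y≼c = walk-confined i a∉p (walk a a∈x a∈y) x≼c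

module _ {n : ℕ} where

  NewVertex : Set
  NewVertex = Σ (Fin n) λ i → Σ (Fin n) λ j → (toℕ i < toℕ j) × ¬ edgeless n i j

  private
    Adj : CompVertex n (edgeless n) → CompVertex n (edgeless n) → Set
    Adj = E (CKbar n)

  CKbar-sym : ∀ {u w} → Adj u w → Adj w u
  CKbar-sym (old ())
  CKbar-sym (newL p q)  = newL' p q
  CKbar-sym (newR p q)  = newR' p q
  CKbar-sym (newL' p q) = newL p q
  CKbar-sym (newR' p q) = newR p q

  old-nonadjacent : ∀ {x y} → ¬ Adj (inj₁ x) (inj₁ y)
  old-nonadjacent (old ())

  newVertex-≡ : ∀ {i j p p′ q q′} →
    _≡_ {A = CompVertex n (edgeless n)} (inj₂ (i , j , p , q)) (inj₂ (i , j , p′ , q′))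
  newVertex-≡ {i} {j} {p} {p′} {q} = cong (λ r → inj₂ (i , j , r , q)) (<-irrelevant p p′)

  midpoint : (x y : Fin n) → x ≢ y → NewVertex
  midpoint x y x≢y with <-cmp x y
  ... | tri< x<y _ _ = x , y , x<y , id
  ... | tri≈ _ x≡y _ = contradiction x≡y x≢y
  ... | tri> _ _ y<x = y , x , y<x , id

  midpoint-adjˡ : ∀ x y x≢y → Adj (inj₂ (midpoint x y x≢y)) (inj₁ x)
  midpoint-adjˡ x y x≢y with <-cmp x y
  ... | tri< x<y _ _ = newL x<y id
  ... | tri≈ _ x≡y _ = contradiction x≡y x≢y
  ... | tri> _ _ y<x = newR y<x id

  midpoint-adjʳ : ∀ x y x≢y → Adj (inj₂ (midpoint x y x≢y)) (inj₁ y)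
  midpoint-adjʳ x y x≢y with <-cmp x y
  ... | tri< x<y _ _ = newR x<y id
  ... | tri≈ _ x≡y _ = contradiction x≡y x≢y
  ... | tri> _ _ y<x = newL y<x id

  newVertex-neighbours : ∀ {i j p q z} → Adj (inj₂ (i , j , p , q)) (inj₁ z) → z ≡ i ⊎ z ≡ j
  newVertex-neighbours (newL _ _) = inj₁ refl
  newVertex-neighbours (newR _ _) = inj₂ refl

  midpoint-neighbours : ∀ x y x≢y {z} → Adj (inj₂ (midpoint x y x≢y)) (inj₁ z) → z ≡ x ⊎ z ≡ y
  midpoint-neighbours x y x≢y e with <-cmp x y
  ... | tri< _ _ _   = newVertex-neighbours e
  ... | tri≈ _ x≡y _ = contradiction x≡y x≢y
  ... | tri> _ _ _   = swap (newVertex-neighbours e)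

originals-independent : ∀ {n′} {X : V (CKbar (suc n′)) → Set} → (∀ j → X (inj₁ j)) →
  IndependentFamily (CKbar (suc n′)) X n′
originals-independent all∈X = record
  { member      = inj₁ ∘ fsuc
  ; injective   = λ { refl → refl }
  ; inside      = all∈X ∘ fsuc
  ; nonadjacent = λ _ _ → old-nonadjacent
  }

module Separation {n′ : ℕ} (D : TreeDecomposition (CKbar (suc n′))) (i : Fin (size (tree D)))
  {a b : Fin (suc n′)}
  (a-below  : OccursBelow D (fsuc i) (inj₁ a))
  (a∉p      : ¬ bag D (parent (tree D) i) (inj₁ a))
  (b-absent : ¬ OccursBelow D (fsuc i) (inj₁ b)) where

  private
    Vertex : Set
    Vertex = V (CKbar (suc n′))
    Adj : Vertex → Vertex → Set
    Adj = E (CKbar (suc n′))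
    p : Node (tree D)
    p = parent (tree D) i
    Below InParent : Fin (suc n′) → Set
    Below j    = OccursBelow D (fsuc i) (inj₁ j)
    InParent j = bag D p (inj₁ j)
    neighbour-of : ∀ {u w z} → u ≡ w → Adj w z → Adj u z
    neighbour-of refl e = e

  a≢ : ∀ {j} → ¬ Below j → a ≢ j
  a≢ ¬below refl = ¬below a-below

  ≢b : ∀ {j} → Below j → j ≢ b
  ≢b below refl = b-absent below

  represent : ∀ j → Dec (Below j) → Dec (InParent j) → Vertex
  represent j (no ¬below) _         = inj₂ (midpoint a j (a≢ ¬below))
  represent j (yes _)     (yes _)   = inj₁ j
  represent j (yes below) (no _)    = inj₂ (midpoint j b (≢b below))

  represent-in-parent : ∀ j below? inParent? → bag D p (represent j below? inParent?)
  represent-in-parent j (no ¬below) _ =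
    common-neighbour-in-parent-bag D i (midpoint-adjˡ a j _) (midpoint-adjʳ a j _) a-below a∉p ¬below
  represent-in-parent j (yes _) (yes j∈p) = j∈p
  represent-in-parent j (yes below) (no j∉p) =
    common-neighbour-in-parent-bag D i (midpoint-adjˡ j b _) (midpoint-adjʳ j b _) below j∉p b-absent

  old-represent-nonadjacent : ∀ {j} → Below j → InParent j →
    ∀ j′ below? inParent? → ¬ Adj (inj₁ j) (represent j′ below? inParent?)
  old-represent-nonadjacent below j∈p j′ (no ¬below′) _ e =
    [ (λ { refl → a∉p j∈p }) , (λ { refl → ¬below′ below }) ] (midpoint-neighbours a j′ _ (CKbar-sym e))
  old-represent-nonadjacent below j∈p j′ (yes _) (yes _) e = old-nonadjacent e
  old-represent-nonadjacent below j∈p j′ (yes _) (no j′∉p) e =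
    [ (λ { refl → j′∉p j∈p }) , (λ { refl → b-absent below }) ] (midpoint-neighbours j′ b _ (CKbar-sym e))

  represent-nonadjacent : ∀ j below? inParent? j′ below?′ inParent?′ →
    ¬ Adj (represent j below? inParent?) (represent j′ below?′ inParent?′)
  represent-nonadjacent j (yes below) (yes j∈p) j′ below?′ inParent?′ =
    old-represent-nonadjacent below j∈p j′ below?′ inParent?′
  represent-nonadjacent j below? inParent? j′ (yes below′) (yes j′∈p) =
    old-represent-nonadjacent below′ j′∈p j below? inParent? ∘ CKbar-sym
  represent-nonadjacent j (no _)  _      j′ (no _)  _      ()
  represent-nonadjacent j (no _)  _      j′ (yes _) (no _) ()
  represent-nonadjacent j (yes _) (no _) j′ (no _)  _      ()
  represent-nonadjacent j (yes _) (no _) j′ (yes _) (no _) ()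

  represent-injective : ∀ {j j′} below? inParent? below?′ inParent?′ → j ≢ a → j′ ≢ a →
    represent j below? inParent? ≡ represent j′ below?′ inParent?′ → j ≡ j′
  represent-injective {j} {j′} (no _) _ (no _) _ j≢a j′≢a eq =
    [ ⊥-elim ∘ j′≢a , sym ] (midpoint-neighbours a j _ (neighbour-of eq (midpoint-adjʳ a j′ _)))
  represent-injective {j} {j′} (no _) _ (yes _) (no _) j≢a j′≢a eq =
    [ ⊥-elim ∘ j′≢a , sym ] (midpoint-neighbours a j _ (neighbour-of eq (midpoint-adjˡ j′ b _)))
  represent-injective {j} {j′} (yes _) (no _) (no _) _ j≢a j′≢a eq =
    [ ⊥-elim ∘ j≢a , id ] (midpoint-neighbours a j′ _ (neighbour-of (sym eq) (midpoint-adjˡ j b _)))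
  represent-injective {j} {j′} (yes _) (no _) (yes below′) (no _) j≢a j′≢a eq =
    [ sym , (λ { refl → ⊥-elim (b-absent below′) }) ]
      (midpoint-neighbours j b _ (neighbour-of eq (midpoint-adjˡ j′ b _)))
  represent-injective (yes _) (yes _) (yes _) (yes _) _ _ refl = refl
  represent-injective (no _)  _       (yes _) (yes _) _ _ ()
  represent-injective (yes _) (no _)  (yes _) (yes _) _ _ ()
  represent-injective (yes _) (yes _) (no _)  _       _ _ ()
  represent-injective (yes _) (yes _) (yes _) (no _)  _ _ ()

  separated-family : (∀ j → Dec (Below j)) → (∀ j → Dec (InParent j)) →
    IndependentFamily (CKbar (suc n′)) (bag D p) n′
  separated-family below? inParent? = record
    { member      = member
    ; injective   = λ {r} {r′} eq → punchIn-injective a r r′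
        (represent-injective (below? _) (inParent? _) (below? _) (inParent? _)
          (punchInᵢ≢i a r) (punchInᵢ≢i a r′) eq)
    ; inside      = λ r → represent-in-parent _ (below? _) (inParent? _)
    ; nonadjacent = λ r r′ → represent-nonadjacent _ (below? _) (inParent? _) _ (below? _) (inParent? _)
    }
    where
    member : Fin n′ → Vertex
    member r = represent (punchIn a r) (below? (punchIn a r)) (inParent? (punchIn a r))

module Descent {n′ : ℕ} (D : TreeDecomposition (CKbar (suc n′)))
  (narrow : ∀ t → ¬ IndependentFamily (CKbar (suc n′)) (bag D t) n′) where
  open RootedTree (tree D)

  -- Bags are arbitrary predicates, so the descent is carried out classically, under ¬ ¬.
  Full : Node (tree D) → Set
  Full t = ∀ j → ¬ ¬ OccursBelow D t (inj₁ j)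

  full-root : Full fz
  full-root j ¬occurs = ¬occurs (occurs-below-root D (inj₁ j))

  full-child : ∀ {t a} → OccursBelow D t (inj₁ a) → ¬ bag D t (inj₁ a) →
    ¬ ¬ ∃ λ s → t F.< s × Full s
  full-child occurs a∉t none with escape-to-child D occurs a∉t
  ... | i , refl , a-below = ¬¬-excluded-middle λ where
    (yes full) → none (fsuc i , parent<child i , full)
    (no ¬full) → ¬full λ b b-absent →
      ¬¬-Π-Fin (λ _ → ¬¬-excluded-middle) λ below? →
      ¬¬-Π-Fin (λ _ → ¬¬-excluded-middle) λ inParent? →
      narrow _ (Separation.separated-family D i a-below a∉t b-absent below? inParent?)

  full-has-full-descendant : ∀ t → Full t → ¬ ¬ ∃ λ s → t F.< s × Full s
  full-has-full-descendant t full none = ¬¬-excluded-middle λ where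
    (no ¬missing)   → ¬¬-Π-Fin (λ j j∉t → ¬missing (j , j∉t)) (narrow t ∘ originals-independent)
    (yes (a , a∉t)) → full a λ occurs → full-child occurs a∉t none

  no-full-node : ∀ t → Acc F._>_ t → ¬ Full t
  no-full-node t (acc rs) full =
    full-has-full-descendant t full λ (s , t<s , full-s) → no-full-node s (rs t<s) full-s

  absurd : ⊥
  absurd = no-full-node fz (>-wellFounded fz) full-root

tree-α-lower : ∀ n′ m → TreeαAtMost (CKbar (suc n′)) m → n′ ≤ m
tree-α-lower n′ m (D , width≤m) = ≮⇒≥ λ m<n′ →
  Descent.absurd D λ t F → <⇒≱ m<n′ (independentFamily-size≤ _ (width≤m t) F)

star : ℕ → Tree
star s = record { size = s ; parent = λ _ → fz ; parent< = λ _ → z≤n }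

star-connected : ∀ {s} {S : Node (star s) → Set} → S fz → ConnectedNonempty (star s) S
star-connected {S = S} S-root = (fz , S-root) , walk-via-root
  where
  walk-via-root : ∀ x y → S x → S y → WalkIn (star _) S x y
  walk-via-root fz       fz       _  Sy = here Sy
  walk-via-root fz       (fsuc j) Sx Sy = step Sx (inj₂ (j , refl , refl)) (here Sy)
  walk-via-root (fsuc i) fz       Sx Sy = step Sx (inj₁ (i , refl , refl)) (here Sy)
  walk-via-root (fsuc i) (fsuc j) Sx Sy =
    step Sx (inj₁ (i , refl , refl)) (step S-root (inj₂ (j , refl , refl)) (here Sy))

module UpperBound (k : ℕ) where

  private
    ℓ n : ℕ
    ℓ = suc k
    n = suc ℓ
    Vertex : Set
    Vertex = V (CKbar n)
    Adj : Vertex → Vertex → Set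
    Adj = E (CKbar n)

  T : Tree
  T = star (suc (ℓ * ℓ))

  open RootedTree T using (singleton-connected)

  pattern hub    = fz
  pattern apex   = fsuc fz
  pattern leaf c = fsuc (fsuc c)

  -- The hub holds the originals other than 0 and the midpoints m_0j, the apex holds 0 and the
  -- midpoints m_0j, and the leaf of a pair (a, b) holds a + 1, b + 1 and their midpoint.
  data HubBag : Vertex → Set where
    original : ∀ x → HubBag (inj₁ (fsuc x))
    spoke    : ∀ {b p q} → HubBag (inj₂ (fz , fsuc b , p , q))

  data ApexBag : Vertex → Set where
    centre : ApexBag (inj₁ fz)
    spoke  : ∀ {b p q} → ApexBag (inj₂ (fz , fsuc b , p , q))

  data LeafBag (c : Fin (ℓ * ℓ)) : Vertex → Set where
    end    : ∀ {a b x} → combine a b ≡ c → x ≡ a ⊎ x ≡ b → LeafBag c (inj₁ (fsuc x))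
    middle : ∀ {a b p q} → combine a b ≡ c → LeafBag c (inj₂ (fsuc a , fsuc b , p , q))

  bags : Node T → Vertex → Set
  bags hub      = HubBag
  bags apex     = ApexBag
  bags (leaf c) = LeafBag c

  cover-new-old : ∀ {w z} → Adj (inj₂ w) (inj₁ z) → ∃ λ t → bags t (inj₂ w) × bags t (inj₁ z)
  cover-new-old (newL {fz}     {fsuc b} _ _) = apex , spoke , centre
  cover-new-old (newR {fz}     {fsuc b} _ _) = hub , spoke , original b
  cover-new-old (newL {fsuc a} {fsuc b} _ _) = leaf (combine a b) , middle refl , end refl (inj₁ refl)
  cover-new-old (newR {fsuc a} {fsuc b} _ _) = leaf (combine a b) , middle refl , end {a = a} refl (inj₂ refl)
  cover-new-old (newL {j = fz} () _)
  cover-new-old (newR {j = fz} () _)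

  cover : ∀ u w → Adj u w → ∃ λ t → bags t u × bags t w
  cover _ _ (old ())
  cover _ _ e@(newL _ _)  = cover-new-old e
  cover _ _ e@(newR _ _)  = cover-new-old e
  cover _ _ e@(newL' _ _) = Product.map₂ Product.swap (cover-new-old (CKbar-sym e))
  cover _ _ e@(newR' _ _) = Product.map₂ Product.swap (cover-new-old (CKbar-sym e))

  connected : ∀ u → ConnectedNonempty T (λ t → bags t u)
  connected (inj₁ fz) = singleton-connected centre only-apex
    where
    only-apex : ∀ t → bags t (inj₁ fz) → t ≡ apex
    only-apex hub      ()
    only-apex apex     centre = refl
    only-apex (leaf c) ()
  connected (inj₁ (fsuc x))            = star-connected (original x)
  connected (inj₂ (fz , fz , () , _))
  connected (inj₂ (fz , fsuc b , _))   = star-connected spoke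
  connected (inj₂ (fsuc _ , fz , () , _))
  connected (inj₂ (fsuc a , fsuc b , _)) = singleton-connected (middle refl) only-leaf
    where
    only-leaf : ∀ t → bags t (inj₂ (fsuc a , fsuc b , _)) → t ≡ leaf (combine a b)
    only-leaf hub      ()
    only-leaf apex     ()
    only-leaf (leaf c) (middle e) = cong leaf (sym e)

  decomposition : TreeDecomposition (CKbar n)
  decomposition = record { tree = T ; bag = bags ; edgeCovered = cover ; vertexConnected = connected }

  colour : ∀ t {u} → bags t u → Fin ℓ
  colour hub      (original x)        = x
  colour hub      (spoke {b})         = b
  colour apex     centre              = fz
  colour apex     (spoke {b})         = b
  colour (leaf c) (end {x = x} _ _)   = x
  colour (leaf c) (middle {a} _)      = a

  clique : ∀ t {u w} (xu : bags t u) (xw : bags t w) → colour t xu ≡ colour t xw → u ≡ w ⊎ Adj u w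
  clique hub      (original _) (original _) refl = inj₁ refl
  clique hub      (original _) spoke        refl = inj₂ (newR' _ _)
  clique hub      spoke        (original _) refl = inj₂ (newR _ _)
  clique hub      spoke        spoke        refl = inj₁ newVertex-≡
  clique apex     centre       centre       _    = inj₁ refl
  clique apex     centre       spoke        _    = inj₂ (newL' _ _)
  clique apex     spoke        centre       _    = inj₂ (newL _ _)
  clique apex     spoke        spoke        refl = inj₁ newVertex-≡
  clique (leaf c) (end _ _)    (end _ _)    refl = inj₁ refl
  clique (leaf c) (end _ _)    (middle _)   refl = inj₂ (newL' _ _)
  clique (leaf c) (middle _)   (end _ _)    refl = inj₂ (newL _ _)
  clique (leaf c) (middle {a} {b} e) (middle {a′} {b′} e′) _
    with combine-injective a b a′ b′ (trans e (sym e′))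
  ... | refl , refl = inj₁ newVertex-≡

  width : TDαWidth≤ (CKbar n) decomposition ℓ
  width t = cliqueCover⇒αInduced≤ (CKbar n) (colour t) (clique t)

tree-α-upper : ∀ k → TreeαAtMost (CKbar (suc (suc k))) (suc k)
tree-α-upper k = UpperBound.decomposition k , UpperBound.width k

lemma2p3 : ∀ (n : ℕ) → 2 ≤ n → TreeαIs (CKbar n) (n ∸ 1)
lemma2p3 1 (s≤s ())
lemma2p3 (suc (suc k)) _ = tree-α-upper k , λ m → tree-α-lower (suc k) m
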